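{- (i) For every column $\gamma$ and every word $w\in A^*$, $w\cdot\gamma\leq\gamma$. (ii) For all columns $\gamma_1,\gamma_2$ and every word $w$, $\gamma_1\leq\gamma_2$ implies $w\cdot\gamma_1\leq w\cdot\gamma_2$.
   Context: $A$ is a finite totally ordered alphabet. A column is a subset of $A$, identified with the strictly decreasing word of its elements. For a column $\gamma$ and a letter $x$: if $x>y$ for all $y\in\gamma$, $x\cdot\gamma=\gamma\cup\{x\}$; otherwise with $y$ the smallest element of $\gamma$ with $y\geq x$, $x\cdot\gamma=(\gamma\setminus\{y\})\cup\{x\}$; this extends to a left action of $A^*$ on columns by $(uv)\cdot\gamma=u\cdot(v\cdot\gamma)$. Order on columns: $\gamma_1\leq\gamma_2$ iff $|\gamma_2|\leq|\gamma_1|$ and, for each $i\leq|\gamma_2|$, the $i$-th smallest element of $\gamma_1$ is $\leq$ the $i$-th smallest element of $\gamma_2$ (equivalently, for nonempty columns, $\gamma_1,\gamma_2$ can be the two columns, from left to right, of a semistandard tableau; the empty column is the maximum). -}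

module Defs where

open import Data.Nat as ℕ using (ℕ; zero; suc)
open import Data.Fin using (Fin; zero; suc; _<_; _≤_; _≟_)
open import Data.Fin.Properties using (_<?_; _≤?_)
open import Data.Fin.Subset using (Subset; ⁅_⁆; _∪_; _∈_; ∣_∣; ⊥)
open import Data.Bool using (Bool; true; false; if_then_else_)
open import Data.Vec using (Vec; []; _∷_; _[_]≔_)
open import Data.List using (List; []; _∷_; length; foldr)
open import Data.Maybe using (Maybe; just; nothing)
open import Data.Product using (Σ; _×_; _,_)
open import Relation.Nullary using (does)

-- The alphabet A is Fin n with its natural total order
-- (every finite totally ordered set is order-isomorphic to some Fin n).
-- A column is a subset of A.
Column : ℕ → Set
Column n = Subset n

elems : ∀ {n} → Column n → List (Fin n)
elems {zero} [] = []
elems {suc n} (b ∷ p) =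
  let rest = Data.List.map suc (elems p) in
  if b then zero ∷ rest else rest

smallest≥ : ∀ {n} → Fin n → List (Fin n) → Maybe (Fin n)
smallest≥ x [] = nothing
smallest≥ x (y ∷ ys) = if does (x ≤? y) then just y else smallest≥ x ys

act : ∀ {n} → Fin n → Column n → Column n
act x γ with smallest≥ x (elems γ)
... | nothing = γ [ x ]≔ true
... | just y  = (γ [ y ]≔ false) [ x ]≔ true

-- Left action of words: (uv)·γ = u·(v·γ), so the rightmost letter acts first.
actWord : ∀ {n} → List (Fin n) → Column n → Column n
actWord w γ = foldr act γ w

data PrefixLe {n : ℕ} : List (Fin n) → List (Fin n) → Set where
  done : ∀ {l₁} → PrefixLe l₁ []
  step : ∀ {x y l₁ l₂} → x ≤ y → PrefixLe l₁ l₂ → PrefixLe (x ∷ l₁) (y ∷ l₂)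

_≤ᶜ_ : ∀ {n} → Column n → Column n → Set
γ₁ ≤ᶜ γ₂ = (length (elems γ₂) ℕ.≤ length (elems γ₁)) × PrefixLe (elems γ₁) (elems γ₂)

-- Read on the increasing list of its elements, a letter x acts on a column by
-- row-insertion bumping: x replaces the smallest entry ≥ x, or is appended if
-- there is none.  The order on columns is entrywise comparison of these lists
-- (the longer list on the left), and bumping is monotone and decreasing for it,
-- letter by letter; both claims then follow by induction on the word.
module Submission where

open import Defs
open import Data.Nat as ℕ using (ℕ; z≤n; s≤s; s≤s⁻¹)
open import Data.Fin using (Fin; zero; suc; toℕ)
open import Data.Fin.Properties using (_≤?_; ≤-refl; ≤-trans)
open import Data.Nat.Properties using (≰⇒≥)
open import Data.Bool using (Bool; true; false)
open import Data.List using (List; []; _∷_; map; length; foldr)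
open import Data.Maybe as Maybe using (Maybe; just; nothing)
open import Data.Vec using (_∷_; _[_]≔_)
open import Data.Product using (_×_; _,_)
open import Data.Empty using (⊥-elim)
open import Relation.Nullary using (does; yes; no)
open import Relation.Binary.PropositionalEquality using (_≡_; refl; cong)

private
  variable
    n : ℕ

bump : Fin n → List (Fin n) → List (Fin n)
bump x [] = x ∷ []
bump x (y ∷ ys) with x ≤? y
... | yes _ = x ∷ ys
... | no  _ = y ∷ bump x ys

bumpWord : List (Fin n) → List (Fin n) → List (Fin n)
bumpWord w l = foldr bump l w

PrefixLe-refl : (l : List (Fin n)) → PrefixLe l l
PrefixLe-refl []      = done
PrefixLe-refl (x ∷ l) = step ≤-refl (PrefixLe-refl l)

PrefixLe-trans : {l₁ l₂ l₃ : List (Fin n)} → PrefixLe l₁ l₂ → PrefixLe l₂ l₃ → PrefixLe l₁ l₃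
PrefixLe-trans _              done           = done
PrefixLe-trans (step x≤y p) (step y≤z q) = step (≤-trans x≤y y≤z) (PrefixLe-trans p q)

PrefixLe⇒length≥ : {l₁ l₂ : List (Fin n)} → PrefixLe l₁ l₂ → length l₂ ℕ.≤ length l₁
PrefixLe⇒length≥ done       = z≤n
PrefixLe⇒length≥ (step _ p) = s≤s (PrefixLe⇒length≥ p)

PrefixLe⇒≤ᶜ : {γ₁ γ₂ : Column n} → PrefixLe (elems γ₁) (elems γ₂) → γ₁ ≤ᶜ γ₂
PrefixLe⇒≤ᶜ p = PrefixLe⇒length≥ p , p

bump-decreasing : (x : Fin n) (l : List (Fin n)) → PrefixLe (bump x l) l
bump-decreasing x []       = done
bump-decreasing x (y ∷ ys) with x ≤? y
... | yes x≤y = step x≤y (PrefixLe-refl ys)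
... | no  _   = step ≤-refl (bump-decreasing x ys)

bump-≤-singleton : (x : Fin n) (l : List (Fin n)) → PrefixLe (bump x l) (x ∷ [])
bump-≤-singleton x []       = step ≤-refl done
bump-≤-singleton x (y ∷ ys) with x ≤? y
... | yes _   = step ≤-refl done
... | no  x≰y = step (≰⇒≥ x≰y) done

bump-mono : (x : Fin n) {l₁ l₂ : List (Fin n)} → PrefixLe l₁ l₂ → PrefixLe (bump x l₁) (bump x l₂)
bump-mono x {l₁} done = bump-≤-singleton x l₁
bump-mono x {y₁ ∷ ys₁} {y₂ ∷ ys₂} (step y₁≤y₂ p) with x ≤? y₁ | x ≤? y₂
... | yes _     | yes _   = step ≤-refl p
... | yes x≤y₁  | no  x≰y₂ = ⊥-elim (x≰y₂ (≤-trans x≤y₁ y₁≤y₂))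
... | no  x≰y₁  | yes _   = step (≰⇒≥ x≰y₁) (PrefixLe-trans (bump-decreasing x ys₁) p)
... | no  _     | no  _   = step y₁≤y₂ (bump-mono x p)

bumpWord-decreasing : (w l : List (Fin n)) → PrefixLe (bumpWord w l) l
bumpWord-decreasing []      l = PrefixLe-refl l
bumpWord-decreasing (x ∷ w) l =
  PrefixLe-trans (bump-decreasing x (bumpWord w l)) (bumpWord-decreasing w l)

bumpWord-mono : (w : List (Fin n)) {l₁ l₂ : List (Fin n)} →
                PrefixLe l₁ l₂ → PrefixLe (bumpWord w l₁) (bumpWord w l₂)
bumpWord-mono []      p = p
bumpWord-mono (x ∷ w) p = bump-mono x (bumpWord-mono w p)

does-suc≤?suc : (x y : Fin n) → does (suc x ≤? suc y) ≡ does (x ≤? y)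
does-suc≤?suc x y with toℕ x
... | ℕ.zero  = refl
... | ℕ.suc _ = refl

bump-suc : (x : Fin n) (l : List (Fin n)) → bump (suc x) (map suc l) ≡ map suc (bump x l)
bump-suc x []       = refl
bump-suc x (y ∷ ys) with suc x ≤? suc y | x ≤? y
... | yes _   | yes _   = refl
... | no  _   | no  _   = cong (suc y ∷_) (bump-suc x ys)
... | yes sx≤sy | no x≰y  = ⊥-elim (x≰y (s≤s⁻¹ sx≤sy))
... | no sx≰sy  | yes x≤y = ⊥-elim (sx≰sy (s≤s x≤y))

smallest≥-suc : (x : Fin n) (l : List (Fin n)) →
                smallest≥ (suc x) (map suc l) ≡ Maybe.map suc (smallest≥ x l)
smallest≥-suc x []       = refl
smallest≥-suc x (y ∷ ys) rewrite does-suc≤?suc x y with does (x ≤? y)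
... | true  = refl
... | false = smallest≥-suc x ys

-- act with its lookup abstracted, so that the lookup can be rewritten under suc.
insertReplacing : Fin n → Column n → Maybe (Fin n) → Column n
insertReplacing x γ nothing  = γ [ x ]≔ true
insertReplacing x γ (just y) = (γ [ y ]≔ false) [ x ]≔ true

act≡insertReplacing : (x : Fin n) (γ : Column n) →
                      act x γ ≡ insertReplacing x γ (smallest≥ x (elems γ))
act≡insertReplacing x γ with smallest≥ x (elems γ)
... | nothing = refl
... | just _  = refl

insertReplacing-suc : (x : Fin n) (b : Bool) (γ : Column n) (m : Maybe (Fin n)) →
                      insertReplacing (suc x) (b ∷ γ) (Maybe.map suc m) ≡ b ∷ insertReplacing x γ m
insertReplacing-suc x b γ nothing  = refl
insertReplacing-suc x b γ (just _) = refl

elems-remove-min : (γ : Column n) {y : Fin n} {ys : List (Fin n)} →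
                   elems γ ≡ y ∷ ys → elems (γ [ y ]≔ false) ≡ ys
elems-remove-min (true ∷ γ) {zero} refl = refl
elems-remove-min (false ∷ γ) eq with elems γ in eqγ
elems-remove-min (false ∷ γ) refl | z ∷ zs = cong (map suc) (elems-remove-min γ eqγ)

elems-insertReplacing : (x : Fin n) (γ : Column n) →
                        elems (insertReplacing x γ (smallest≥ x (elems γ))) ≡ bump x (elems γ)
elems-insertReplacing zero (true ∷ γ) = refl
elems-insertReplacing zero (false ∷ γ) with elems γ in eqγ
... | []     = cong (λ l → zero ∷ map suc l) eqγ
... | z ∷ zs = cong (λ l → zero ∷ map suc l) (elems-remove-min γ eqγ)
elems-insertReplacing (suc x) (true ∷ γ)
  rewrite smallest≥-suc x (elems γ)
        | insertReplacing-suc x true γ (smallest≥ x (elems γ))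
        | elems-insertReplacing x γ
        | bump-suc x (elems γ) = refl
elems-insertReplacing (suc x) (false ∷ γ)
  rewrite smallest≥-suc x (elems γ)
        | insertReplacing-suc x false γ (smallest≥ x (elems γ))
        | elems-insertReplacing x γ
        | bump-suc x (elems γ) = refl

elems-act : (x : Fin n) (γ : Column n) → elems (act x γ) ≡ bump x (elems γ)
elems-act x γ rewrite act≡insertReplacing x γ = elems-insertReplacing x γ

elems-actWord : (w : List (Fin n)) (γ : Column n) → elems (actWord w γ) ≡ bumpWord w (elems γ)
elems-actWord []      γ = refl
elems-actWord (x ∷ w) γ rewrite elems-act x (actWord w γ) = cong (bump x) (elems-actWord w γ)

actWord-decreasing : (w : List (Fin n)) (γ : Column n) →
                     PrefixLe (elems (actWord w γ)) (elems γ)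
actWord-decreasing w γ rewrite elems-actWord w γ = bumpWord-decreasing w (elems γ)

actWord-mono : (w : List (Fin n)) {γ₁ γ₂ : Column n} → PrefixLe (elems γ₁) (elems γ₂) →
               PrefixLe (elems (actWord w γ₁)) (elems (actWord w γ₂))
actWord-mono w {γ₁} {γ₂} p rewrite elems-actWord w γ₁ | elems-actWord w γ₂ = bumpWord-mono w p

proposition10p1 : (n : ℕ) →
    ((γ : Column n) (w : List (Fin n)) → actWord w γ ≤ᶜ γ) ×
    ((γ₁ γ₂ : Column n) (w : List (Fin n)) → γ₁ ≤ᶜ γ₂ → actWord w γ₁ ≤ᶜ actWord w γ₂)
proposition10p1 n =
  (λ γ w → PrefixLe⇒≤ᶜ {γ₁ = actWord w γ} (actWord-decreasing w γ)) ,
  (λ γ₁ γ₂ w (_ , p) → PrefixLe⇒≤ᶜ {γ₁ = actWord w γ₁} {γ₂ = actWord w γ₂} (actWord-mono w p))
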